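{- The class $\mathcal{C}$ of all finite digraphs that contain a directed cycle can be decided by an adaptive left unbounded query algorithm over $\mathbb{B}$, but not by an adaptive left $k$-query algorithm over $\mathbb{B}$, for any $k$.
   Context: Digraphs are finite structures $(V,R)$, $V\ne\varnothing$, $R\subseteq V\times V$; a directed cycle is a sequence of distinct vertices $a_0,\dots,a_{\ell-1}$ ($\ell\ge1$) with $(a_i,a_{i+1})\in R$ for $i<\ell-1$ and $(a_{\ell-1},a_0)\in R$. $\mathsf{FIN}$ is the class of all digraphs. $\hom_{\mathbb{B}}(F,A)$ is $1$ if there is a homomorphism $F\to A$ and $0$ otherwise. For a set $\Sigma$, $\Sigma^{<\omega}$ is the set of finite strings over $\Sigma$; a subtree is a prefix-closed subset, a leaf an element with no proper extension. An adaptive left unbounded query algorithm over $\mathbb{B}$ is a function $G:\mathcal{T}\to\mathsf{FIN}\cup\{\mathsf{YES},\mathsf{NO}\}$ with $\mathcal{T}\subseteq\{0,1\}^{<\omega}$ a subtree and $G(\sigma)\in\{\mathsf{YES},\mathsf{NO}\}$ iff $\sigma$ is a leaf; its computation path on $A$ is the (possibly infinite) limit of $\sigma_0=\varepsilon$, $\sigma_{i+1}=\sigma_i$ if $G(\sigma_i)\in\{\mathsf{YES},\mathsf{NO}\}$, else $\sigma_{i+1}=\sigma_i\bullet\hom_{\mathbb{B}}(G(\sigma_i),A)$. Only total algorithms are considered: the path must be finite for every input; the algorithm decides $\{A:G(\text{path of }A)=\mathsf{YES}\}$. It is an adaptive left $k$-query algorithm if all computation paths have length at most $k$. -}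

module Defs where

open import Data.Nat using (ℕ; suc; _≤_)
open import Data.Fin using (Fin; zero; suc; inject₁; fromℕ)
open import Data.Bool using (Bool; true; false)
open import Data.List using (List; []; _∷_; _++_; length)
open import Data.Product using (Σ; ∃; ∃-syntax; _×_; _,_)
open import Data.Empty using (⊥)
open import Relation.Nullary using (¬_)
open import Relation.Binary.PropositionalEquality using (_≡_)
open import Function.Definitions using (Injective)
open import Function.Bundles using (_⇔_)

-- Finite digraphs (V , R) with V ≠ ∅ : vertex set Fin (suc n),
-- edge relation given by a Boolean-valued function.

record Digraph : Set where
  constructor digraph
  field
    n    : ℕ
    edge : Fin (suc n) → Fin (suc n) → Bool

  V : Set
  V = Fin (suc n)

  R : V → V → Set
  R x y = edge x y ≡ true

open Digraph public

HasDirectedCycle : Digraph → Set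
HasDirectedCycle A =
  Σ ℕ λ ℓ → Σ (Fin (suc ℓ) → V A) λ a →
    Injective _≡_ _≡_ a
    × (∀ (i : Fin ℓ) → R A (a (inject₁ i)) (a (suc i)))
    × R A (a (fromℕ ℓ)) (a zero)

Hom : Digraph → Digraph → Set
Hom F A = Σ (V F → V A) λ f → ∀ x y → R F x y → R A (f x) (f y)

-- hom_𝔹(F , A) = b, stated relationally.
HomB : Digraph → Digraph → Bool → Set
HomB F A true  = Hom F A
HomB F A false = ¬ Hom F A

-- Labels: a query digraph in FIN, or an answer (true = YES, false = NO).
data Node : Set where
  query  : Digraph → Node
  answer : Bool → Node

_•_ : List Bool → Bool → List Bool
σ • b = σ ++ (b ∷ [])

IsAnswer : Node → Set
IsAnswer (query _)  = ⊥
IsAnswer (answer _) = Data.Unit.⊤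
  where import Data.Unit

-- G : 𝒯 → FIN ∪ {YES, NO}.  G is given on all strings, only its values on
-- 𝒯 are relevant (the computation never leaves 𝒯).
record Algorithm : Set₁ where
  field
    T : List Bool → Set
    G : List Bool → Node

open Algorithm public

IsLeaf : Algorithm → List Bool → Set
IsLeaf alg σ = ∀ τ → T alg (σ ++ τ) → τ ≡ []

IsAlgorithm : Algorithm → Set
IsAlgorithm alg =
    (∀ σ τ → T alg (σ ++ τ) → T alg σ)
  × (∀ σ → T alg σ → (IsAnswer (G alg σ) ⇔ IsLeaf alg σ))

data OnPath (alg : Algorithm) (A : Digraph) : List Bool → Set where
  start : T alg [] → OnPath alg A []
  step  : ∀ {σ F b} → OnPath alg A σ → G alg σ ≡ query F →
          HomB F A b → T alg (σ • b) → OnPath alg A (σ • b)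

Decides : Algorithm → (Digraph → Set) → Set
Decides alg C = ∀ A → Σ (List Bool) λ σ → OnPath alg A σ ×
  Σ Bool λ b → (G alg σ ≡ answer b) × ((b ≡ true) ⇔ C A)

IsKQuery : ℕ → Algorithm → Set
IsKQuery k alg = ∀ A σ → OnPath alg A σ → length σ ≤ k

{-# OPTIONS --safe #-}
-- A digraph A has a directed cycle iff some cycle maps into A, and it is
-- acyclic iff some path does not.  So in round m = 0, 1, … the algorithm
-- asks whether the cycle with m + 1 vertices maps into A (then YES) and, if
-- not, whether the path with m + 2 vertices does (if not, NO).  A hom from
-- the shortest cycle that maps into A is injective, hence a directed cycle;
-- and a path with more vertices than A maps into A only along a closed walk,
-- so round |A| is never reached.
--
-- No bounded number of queries suffices: a hom from a digraph with fewer
-- than N vertices into the cycle with N vertices misses a vertex, and the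
-- cycle minus a vertex is a path.  So digraphs of size below N cannot tell
-- the N-cycle from the N-path apart, while a k-query algorithm only ever
-- asks queries of bounded size.
module Submission where

open import Defs
open import Data.Nat using (ℕ)
open import Data.Product using (Σ; _×_)
open import Relation.Nullary using (¬_)

open import Data.Bool using (Bool; true; false)
import Data.Bool as Bool
open import Data.Empty using (⊥)
open import Data.Fin using (Fin; zero; suc; toℕ; fromℕ; fromℕ<; inject₁; lower₁)
open import Data.Fin.Properties
  using (toℕ-injective; toℕ<n; toℕ≤pred[n]; toℕ-fromℕ; toℕ-fromℕ<; toℕ-inject₁;
         inject₁-lower₁; pigeonhole; injective⇒≤; ¬∀⟶∃¬; any?; all?)
import Data.Fin.Properties as Fin
open import Data.List using (List; []; _∷_; _++_; length)
open import Data.List.Properties using (length-++; ++-assoc; ++-identityʳ)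
open import Data.Nat using (zero; suc; _+_; _∸_; _≤_; _<_; _⊔_; _⊓_; s≤s; s≤s⁻¹; _<?_)
import Data.Nat as ℕ
open import Data.Nat.Properties
open import Data.Product using (_,_; proj₁; proj₂; ∃; ∃-syntax; map₁; map₂)
open import Data.Sum using (_⊎_; inj₁; inj₂)
open import Data.Unit using (⊤; tt)
open import Data.Vec.Functional as Vector using (Vector; head; tail)
open import Function using (id; _∘_; _⇔_; mk⇔; Equivalence)
open import Function.Definitions using (Injective)
open import Relation.Binary using (Decidable; tri<; tri≈; tri>)
open import Relation.Binary.PropositionalEquality
open import Relation.Nullary using (Dec; yes; no; does; contradiction)
open import Relation.Nullary.Decidable
  using (dec-true; map′; _⊎-dec_; _×-dec_; _→-dec_)

-- Paths and cycles

fromRel : ∀ n {P : Fin (suc n) → Fin (suc n) → Set} → Decidable P → Digraph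
fromRel n P? = digraph n (λ x y → does (P? x y))

module _ {n} {P : Fin (suc n) → Fin (suc n) → Set} (P? : Decidable P) where

  fromRel-sound : ∀ {x y} → R (fromRel n P?) x y → P x y
  fromRel-sound {x} {y} with P? x y
  ... | yes p = λ _ → p
  ... | no _  = λ ()

  fromRel-complete : ∀ {x y} → P x y → R (fromRel n P?) x y
  fromRel-complete {x} {y} = dec-true (P? x y)

PathEdge : ∀ {n} → Fin n → Fin n → Set
PathEdge x y = suc (toℕ x) ≡ toℕ y

CycleEdge : ∀ n → Fin (suc n) → Fin (suc n) → Set
CycleEdge n x y = PathEdge x y ⊎ (toℕ x ≡ n × toℕ y ≡ 0)

pathEdge? : ∀ {n} → Decidable (PathEdge {n})
pathEdge? x y = suc (toℕ x) ℕ.≟ toℕ y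

cycleEdge? : ∀ n → Decidable (CycleEdge n)
cycleEdge? n x y = pathEdge? x y ⊎-dec ((toℕ x ℕ.≟ n) ×-dec (toℕ y ℕ.≟ 0))

-- Both have the n + 1 vertices 0, 1, …, n.
path cycle : ℕ → Digraph
path n = fromRel n pathEdge?
cycle n = fromRel n (cycleEdge? n)

_∘ₕ_ : ∀ {F A B} → Hom A B → Hom F A → Hom F B
(g , g-hom) ∘ₕ (f , f-hom) = g ∘ f , λ x y → g-hom (f x) (f y) ∘ f-hom x y

path↦cycle : ∀ n → Hom (path n) (cycle n)
path↦cycle n = id , λ x y →
  fromRel-complete (cycleEdge? n) {x} {y} ∘ inj₁ ∘ fromRel-sound pathEdge? {x} {y}

injectiveCycleHom⇒directedCycle : ∀ {A} m (h : Hom (cycle m) A) →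
  Injective _≡_ _≡_ (proj₁ h) → HasDirectedCycle A
injectiveCycleHom⇒directedCycle {A} m (h , hom) h-injective =
  m , h , h-injective , forward , back
  where
  forward : ∀ i → R A (h (inject₁ i)) (h (suc i))
  forward i = hom (inject₁ i) (suc i)
    (fromRel-complete (cycleEdge? m) (inj₁ (cong suc (toℕ-inject₁ i))))
  back : R A (h (fromℕ m)) (h zero)
  back = hom (fromℕ m) zero (fromRel-complete (cycleEdge? m) (inj₂ (toℕ-fromℕ m , refl)))

cycle-hasDirectedCycle : ∀ n → HasDirectedCycle (cycle n)
cycle-hasDirectedCycle n = injectiveCycleHom⇒directedCycle n (id , λ _ _ → id) id

increasing⇒acyclic : ∀ {A} (f : V A → ℕ) → (∀ {x y} → R A x y → f x < f y) →
  ¬ HasDirectedCycle A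
increasing⇒acyclic {A} f f-< (ℓ , a , _ , forward , back) =
  <⇒≱ (f-< back) (along ℓ a forward)
  where
  along : ∀ ℓ (a : Fin (suc ℓ) → V A) → (∀ i → R A (a (inject₁ i)) (a (suc i))) →
          f (a zero) ≤ f (a (fromℕ ℓ))
  along zero    a forward = ≤-refl
  along (suc ℓ) a forward = ≤-trans (along ℓ (a ∘ inject₁) (forward ∘ inject₁))
                                    (<⇒≤ (f-< (forward (fromℕ ℓ))))

path-acyclic : ∀ n → ¬ HasDirectedCycle (path n)
path-acyclic n = increasing⇒acyclic toℕ
  λ {x} {y} e → ≤-reflexive (fromRel-sound pathEdge? {x} {y} e)

-- Walks

IsWalk : (A : Digraph) → ℕ → (ℕ → V A) → Set
IsWalk A p w = ∀ {t} → t < p → R A (w t) (w (suc t))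

IsWalk-segment : ∀ {A p w} i q → i + q ≤ p → IsWalk A p w →
  IsWalk A q (λ t → w (i + t))
IsWalk-segment {A} {w = w} i q i+q≤p walk {t} t<q =
  subst (R A (w (i + t)) ∘ w) (sym (+-suc i t))
        (walk (≤-trans (+-monoʳ-< i t<q) i+q≤p))

closedWalk⇒cycleHom : ∀ {A} d {w : ℕ → V A} → IsWalk A (suc d) w →
  w (suc d) ≡ w 0 → Hom (cycle d) A
closedWalk⇒cycleHom {A} d {w} walk closed =
  w ∘ toℕ , λ x y → arc ∘ fromRel-sound (cycleEdge? d) {x} {y}
  where
  arc : ∀ {x y} → CycleEdge d x y → R A (w (toℕ x)) (w (toℕ y))
  arc {x} (inj₁ x→y) = subst (R A (w (toℕ x)) ∘ w) x→y (walk (toℕ<n x))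
  arc (inj₂ (x≡d , y≡0)) = subst₂ (λ s t → R A (w s) (w t)) (sym x≡d) (sym y≡0)
                                  (subst (R A (w d)) closed (walk ≤-refl))

repeatedVertex⇒cycleHom : ∀ {A p} {w : ℕ → V A} → IsWalk A p w →
  ∀ {i j} → i < j → j ≤ p → w i ≡ w j → ∃[ d ] d < p × Hom (cycle d) A
repeatedVertex⇒cycleHom {A} {p} {w} walk {i} {j} i<j j≤p wi≡wj =
  d , ≤-trans (m≤n+m (suc d) i) i+1+d≤p , closedWalk⇒cycleHom {A} d segment closed
  where
  d = j ∸ suc i
  i+1+d≡j : i + suc d ≡ j
  i+1+d≡j = trans (+-suc i d) (m+[n∸m]≡n i<j)
  i+1+d≤p : i + suc d ≤ p
  i+1+d≤p = subst (_≤ p) (sym i+1+d≡j) j≤p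
  segment : IsWalk A (suc d) (λ t → w (i + t))
  segment = IsWalk-segment {A} {w = w} i (suc d) i+1+d≤p walk
  closed : w (i + suc d) ≡ w (i + 0)
  closed = begin
    w (i + suc d) ≡⟨ cong w i+1+d≡j ⟩
    w j           ≡⟨ sym wi≡wj ⟩
    w i           ≡⟨ cong w (sym (+-identityʳ i)) ⟩
    w (i + 0)     ∎
    where open ≡-Reasoning

clamp : ∀ n → ℕ → Fin (suc n)
clamp n t = fromℕ< (s≤s (m⊓n≤n t n))

toℕ-clamp : ∀ {n t} → t ≤ n → toℕ (clamp n t) ≡ t
toℕ-clamp t≤n = trans (toℕ-fromℕ< _) (m≤n⇒m⊓n≡m t≤n)

walkOf : ∀ {A p} → Hom (path p) A → ℕ → V A
walkOf {p = p} (h , _) t = h (clamp p t)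

walkOf-toℕ : ∀ {A p} (h : Hom (path p) A) x → walkOf {A} h (toℕ x) ≡ proj₁ h x
walkOf-toℕ (h , _) x = cong h (toℕ-injective (toℕ-clamp (toℕ≤pred[n] x)))

walkOf-isWalk : ∀ {A p} (h : Hom (path p) A) → IsWalk A p (walkOf {A} h)
walkOf-isWalk {p = p} (h , hom) {t} t<p = hom (clamp p t) (clamp p (suc t))
  (fromRel-complete pathEdge? (trans (cong suc (toℕ-clamp (<⇒≤ t<p)))
                                     (sym (toℕ-clamp t<p))))

pathHom-collision⇒cycleHom : ∀ {A p} (h : Hom (path p) A) {x y} →
  toℕ x < toℕ y → proj₁ h x ≡ proj₁ h y → ∃[ d ] d < p × Hom (cycle d) A
pathHom-collision⇒cycleHom {A} h {x} {y} x<y hx≡hy =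
  repeatedVertex⇒cycleHom {A} {w = walkOf {A} h} (walkOf-isWalk {A} h)
    x<y (toℕ≤pred[n] y)
    (trans (walkOf-toℕ {A} h x) (trans hx≡hy (sym (walkOf-toℕ {A} h y))))

longPath⇒cycleHom : ∀ {A} → Hom (path (suc (Digraph.n A))) A →
  ∃[ d ] d ≤ Digraph.n A × Hom (cycle d) A
longPath⇒cycleHom {A} h
  with i , j , i<j , hi≡hj ← pigeonhole (n<1+n (suc (Digraph.n A))) (proj₁ h)
  = map₂ (map₁ s≤s⁻¹) (pathHom-collision⇒cycleHom {A} h i<j hi≡hj)

NoCycleHomBelow : ℕ → Digraph → Set
NoCycleHomBelow m A = ∀ {d} → d < m → ¬ Hom (cycle d) A

shortestCycleHom⇒directedCycle : ∀ {A m} → Hom (cycle m) A → NoCycleHomBelow m A →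
  HasDirectedCycle A
shortestCycleHom⇒directedCycle {A} {m} h none =
  injectiveCycleHom⇒directedCycle {A} m h injective
  where
  noCollision : ∀ {x y} → toℕ x < toℕ y → proj₁ h x ≢ proj₁ h y
  noCollision x<y hx≡hy
    with d , d<m , g ← pathHom-collision⇒cycleHom {A}
                         (_∘ₕ_ {B = A} h (path↦cycle m)) x<y hx≡hy
    = none d<m g
  injective : Injective _≡_ _≡_ (proj₁ h)
  injective {x} {y} hx≡hy with <-cmp (toℕ x) (toℕ y)
  ... | tri< x<y _ _ = contradiction hx≡hy (noCollision x<y)
  ... | tri≈ _ x≡y _ = toℕ-injective x≡y
  ... | tri> _ _ y<x = contradiction (sym hx≡hy) (noCollision y<x)

successorWalk⇒pathHom : ∀ {A} {X : Set} (a : X → V A) (next : X → X) →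
  (∀ x → R A (a x) (a (next x))) → X → ∀ p → Hom (path p) A
successorWalk⇒pathHom {A} {X} a next a-next x₀ p = a ∘ visit ∘ toℕ , arc
  where
  visit : ℕ → X
  visit zero    = x₀
  visit (suc t) = next (visit t)
  arc : ∀ x y → R (path p) x y → R A (a (visit (toℕ x))) (a (visit (toℕ y)))
  arc x y e = subst (R A (a (visit (toℕ x))) ∘ a ∘ visit)
                    (fromRel-sound pathEdge? {x} {y} e) (a-next (visit (toℕ x)))

directedCycle⇒pathHom : ∀ {A} → HasDirectedCycle A → ∀ p → Hom (path p) A
directedCycle⇒pathHom {A} (ℓ , a , _ , forward , back) =
  successorWalk⇒pathHom {A} a next a-next zero
  where
  next : Fin (suc ℓ) → Fin (suc ℓ)
  next i with ℓ ℕ.≟ toℕ i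
  ... | yes _   = zero
  ... | no ℓ≢i = suc (lower₁ i ℓ≢i)
  a-next : ∀ i → R A (a i) (a (next i))
  a-next i with ℓ ℕ.≟ toℕ i
  ... | yes ℓ≡i = subst (λ j → R A (a j) (a zero))
                        (toℕ-injective (trans (toℕ-fromℕ ℓ) ℓ≡i)) back
  ... | no ℓ≢i = subst (λ j → R A (a j) (a (suc (lower₁ i ℓ≢i))))
                       (inject₁-lower₁ i ℓ≢i) (forward (lower₁ i ℓ≢i))

-- Cutting a cycle open

missedVertex : ∀ {p q} → p < q → (h : Fin (suc p) → Fin (suc q)) →
  ∃[ c ] ∀ x → h x ≢ c
missedVertex {q = q} p<q h =
  map₂ (λ ¬hit x hx≡c → ¬hit (x , hx≡c))
       (¬∀⟶∃¬ _ Hit (λ c → any? (λ x → h x Fin.≟ c)) notSurjective)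
  where
  Hit : Fin (suc q) → Set
  Hit c = ∃[ x ] h x ≡ c
  notSurjective : ¬ (∀ c → Hit c)
  notSurjective hit = <⇒≱ (s≤s p<q) (injective⇒≤ section-injective)
    where
    section-injective : Injective _≡_ _≡_ (proj₁ ∘ hit)
    section-injective {c} {c′} e =
      trans (sym (proj₂ (hit c))) (trans (cong h e) (proj₂ (hit c′)))

-- Cutting cycle q between c and c + 1 leaves the path c + 1, …, q, 0, …, c;
-- rotate q c u is the position of u on it.
rotate : ℕ → ℕ → ℕ → ℕ
rotate q c u with c <? u
... | yes _ = u ∸ suc c
... | no _  = u + (q ∸ c)

rotate-≤ : ∀ {q c u} → c ≤ q → u ≤ q → rotate q c u ≤ q
rotate-≤ {q} {c} {u} c≤q u≤q with c <? u
... | yes _   = ≤-trans (m∸n≤m u (suc c)) u≤q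
... | no c≮u = ≤-trans (+-monoˡ-≤ (q ∸ c) (≮⇒≥ c≮u)) (≤-reflexive (m+[n∸m]≡n c≤q))

rotate-arc : ∀ {q c u v} → c ≤ q → u ≢ c → suc u ≡ v ⊎ (u ≡ q × v ≡ 0) →
  suc (rotate q c u) ≡ rotate q c v
rotate-arc {c = c} {u} c≤q u≢c (inj₁ refl) with c <? u | c <? suc u
... | yes c<u | yes _     = sym (+-∸-assoc 1 c<u)
... | yes c<u | no c≮1+u = contradiction (m<n⇒m<1+n c<u) c≮1+u
... | no c≮u  | yes c<1+u = contradiction (≤∧≢⇒< (s≤s⁻¹ c<1+u) (u≢c ∘ sym)) c≮u
... | no _    | no _      = refl
rotate-arc {c = c} {u} c≤u u≢c (inj₂ (refl , refl)) with c <? u | c <? 0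
... | _       | yes ()
... | yes c<u | no _ = sym (+-∸-assoc 1 c<u)
... | no c≮u  | no _ = contradiction (≤∧≢⇒< c≤u (u≢c ∘ sym)) c≮u

cutAfter : ∀ {q} → Fin (suc q) → Fin (suc q) → Fin (suc q)
cutAfter c x = fromℕ< (s≤s (rotate-≤ (toℕ≤pred[n] c) (toℕ≤pred[n] x)))

cutAfter-arc : ∀ {q} {c x y : Fin (suc q)} → x ≢ c → CycleEdge q x y →
  PathEdge (cutAfter c x) (cutAfter c y)
cutAfter-arc {c = c} x≢c e = trans (cong suc (toℕ-fromℕ< _))
  (trans (rotate-arc (toℕ≤pred[n] c) (x≢c ∘ toℕ-injective) e) (sym (toℕ-fromℕ< _)))

cycleHom⇒pathHom : ∀ {F q} → Digraph.n F < q → Hom F (cycle q) → Hom F (path q)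
cycleHom⇒pathHom {q = q} small (h , hom) with c , missed ← missedVertex small h =
  cutAfter c ∘ h , λ x y e →
    fromRel-complete pathEdge? (cutAfter-arc (missed x)
      (fromRel-sound (cycleEdge? q) {h x} {h y} (hom x y e)))

cycleHom⇔pathHom : ∀ {F q} → Digraph.n F < q → Hom F (cycle q) ⇔ Hom F (path q)
cycleHom⇔pathHom {q = q} small =
  mk⇔ (cycleHom⇒pathHom small) (_∘ₕ_ {B = cycle q} (path↦cycle q))

HomB-functional : ∀ {F A} b b′ → HomB F A b → HomB F A b′ → b ≡ b′
HomB-functional true  true  _ _  = refl
HomB-functional true  false f ¬f = contradiction f ¬f
HomB-functional false true  ¬f f = contradiction f ¬f
HomB-functional false false _ _  = refl

HomB-transport : ∀ {F A B} b → (Hom F A ⇔ Hom F B) → HomB F A b → HomB F B b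
HomB-transport true  A⇔B = Equivalence.to A⇔B
HomB-transport false A⇔B ¬f = ¬f ∘ Equivalence.from A⇔B

anyVector? : ∀ a {q} {P : Vector (Fin q) a → Set} →
  (∀ {f g} → f ≗ g → P f → P g) → (∀ f → Dec (P f)) → Dec (∃ P)
anyVector? zero    P-resp P? =
  map′ (Vector.[] ,_) (λ (f , p) → P-resp (λ ()) p) (P? Vector.[])
anyVector? (suc a) P-resp P? =
  map′ (λ (x , f , p) → x Vector.∷ f , p)
       (λ (f , p) → head f , tail f , P-resp (λ { zero → refl ; (suc i) → refl }) p)
       (any? λ x → anyVector? a
          (λ f≗g → P-resp (λ { zero → refl ; (suc i) → f≗g i }))
          (P? ∘ (x Vector.∷_)))

hom? : ∀ F A → Dec (Hom F A)
hom? F A = anyVector? (suc (Digraph.n F))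
  (λ f≗g f-hom x y e → subst₂ (R A) (f≗g x) (f≗g y) (f-hom x y e))
  (λ f → all? λ x → all? λ y → R? F x y →-dec R? A (f x) (f y))
  where
  R? : ∀ G → Decidable (R G)
  R? G x y = edge G x y Bool.≟ true

-- Computation paths

length-• : ∀ σ b → length (σ • b) ≡ suc (length σ)
length-• σ b = trans (length-++ σ) (+-comm (length σ) 1)

OnPath-unique : ∀ {alg A σ τ} → OnPath alg A σ → OnPath alg A τ →
  length σ ≡ length τ → σ ≡ τ
OnPath-unique (start _) (start _) _ = refl
OnPath-unique (start _) (step {σ} {b = b} _ _ _ _) 0≡ =
  contradiction (trans 0≡ (length-• σ b)) 0≢1+n
OnPath-unique (step {σ} {b = b} _ _ _ _) (start _) ≡0 =
  contradiction (trans (sym ≡0) (length-• σ b)) 0≢1+n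
OnPath-unique (step {σ} {b = b} p Gσ hb _) (step {τ} {b = b′} q Gτ hb′ _) same
  with refl ← OnPath-unique p q
                (suc-injective (trans (sym (length-• σ b)) (trans same (length-• τ b′))))
  with refl ← trans (sym Gσ) Gτ
  with refl ← HomB-functional b b′ hb hb′
  = refl

answered⇒maximal : ∀ {alg A σ τ b} → OnPath alg A σ → OnPath alg A τ →
  G alg σ ≡ answer b → length σ ≤ length τ → σ ≡ τ
answered⇒maximal p (start t) _ σ≤0 = OnPath-unique p (start t) (n≤0⇒n≡0 σ≤0)
answered⇒maximal {σ = σ} p q@(step {τ} {b = b} q′ Gτ _ _) Gσ σ≤τ•b
  with m≤n⇒m<n∨m≡n (subst (length σ ≤_) (length-• τ b) σ≤τ•b)
... | inj₂ σ≡τ•b = OnPath-unique p q (trans σ≡τ•b (sym (length-• τ b)))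
... | inj₁ σ<τ•b with refl ← answered⇒maximal p q′ Gσ (s≤s⁻¹ σ<τ•b)
  = contradiction (trans (sym Gσ) Gτ) λ ()

answered-unique : ∀ {alg A σ τ b b′} → OnPath alg A σ → OnPath alg A τ →
  G alg σ ≡ answer b → G alg τ ≡ answer b′ → σ ≡ τ
answered-unique {σ = σ} {τ} p q Gσ Gτ with ≤-total (length σ) (length τ)
... | inj₁ σ≤τ = answered⇒maximal p q Gσ σ≤τ
... | inj₂ τ≤σ = sym (answered⇒maximal q p Gτ τ≤σ)

querySize : Node → ℕ
querySize (query F)  = Digraph.n F
querySize (answer _) = 0

maxQuerySize : Algorithm → ℕ → List Bool → ℕ
maxQuerySize alg zero    σ = 0
maxQuerySize alg (suc k) σ = querySize (G alg σ) ⊔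
  (maxQuerySize alg k (σ • false) ⊔ maxQuerySize alg k (σ • true))

querySize≤max : ∀ alg k σ τ → length τ < k →
  querySize (G alg (σ ++ τ)) ≤ maxQuerySize alg k σ
querySize≤max alg (suc k) σ [] _ rewrite ++-identityʳ σ = m≤m⊔n _ _
querySize≤max alg (suc k) σ (b ∷ τ) (s≤s τ<k) rewrite sym (++-assoc σ (b ∷ []) τ) =
  ≤-trans (querySize≤max alg k (σ • b) τ τ<k)
          (≤-trans (branch b) (m≤n⊔m (querySize (G alg σ)) _))
  where
  branch : ∀ b → maxQuerySize alg k (σ • b) ≤
                 maxQuerySize alg k (σ • false) ⊔ maxQuerySize alg k (σ • true)
  branch false = m≤m⊔n _ _
  branch true  = m≤n⊔m _ _

HomEquivalentUpTo : ℕ → Digraph → Digraph → Set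
HomEquivalentUpTo M A B = ∀ F → Digraph.n F ≤ M → Hom F A ⇔ Hom F B

OnPath-transfer : ∀ {alg k A B} →
  HomEquivalentUpTo (maxQuerySize alg k []) A B →
  ∀ {σ} → OnPath alg A σ → length σ ≤ k → OnPath alg B σ
OnPath-transfer agree (start t) _ = start t
OnPath-transfer {alg} {k} agree (step {σ} {F} {b} p GF hb t) σ•b≤k =
  step (OnPath-transfer {alg} {k} agree p (<⇒≤ σ<k)) GF
       (HomB-transport b (agree F small) hb) t
  where
  σ<k : length σ < k
  σ<k = subst (_≤ k) (length-• σ b) σ•b≤k
  small : Digraph.n F ≤ maxQuerySize alg k []
  small = subst (λ node → querySize node ≤ maxQuerySize alg k []) GF
                (querySize≤max alg k [] σ σ<k)

kQuery-invariant : ∀ {alg k C A B} → Decides alg C → IsKQuery k alg →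
  HomEquivalentUpTo (maxQuerySize alg k []) A B → C A → C B
kQuery-invariant {alg} {k} {A = A} {B} decides bounded agree cA
  with σ , onA , b , Gσ , b⇔A ← decides A
  with τ , onB , b′ , Gτ , b′⇔B ← decides B
  with refl ← answered-unique
                (OnPath-transfer {alg} {k} agree onA (bounded A σ onA)) onB Gσ Gτ
  with refl ← trans (sym Gσ) Gτ
  = Equivalence.to b′⇔B (Equivalence.from b⇔A cA)

noKQueryAlgorithm : ∀ k → ¬ (Σ Algorithm λ alg →
  IsAlgorithm alg × Decides alg HasDirectedCycle × IsKQuery k alg)
noKQueryAlgorithm k (alg , _ , decides , bounded) =
  path-acyclic (suc M)
    (kQuery-invariant {alg} {k} {A = cycle (suc M)} {B = path (suc M)}
      decides bounded (λ F F≤M → cycleHom⇔pathHom (s≤s F≤M))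
      (cycle-hasDirectedCycle (suc M)))
  where
  M = maxQuerySize alg k []

-- The cycle search

-- The label of σ when σ is read from the start of round m.
cycleSearch : ℕ → List Bool → Node
cycleSearch m []                  = query (cycle m)
cycleSearch m (true ∷ _)          = answer true
cycleSearch m (false ∷ [])        = query (path (suc m))
cycleSearch m (false ∷ false ∷ _) = answer false
cycleSearch m (false ∷ true ∷ σ)  = cycleSearch (suc m) σ

CycleSearchTree : List Bool → Set
CycleSearchTree []                      = ⊤
CycleSearchTree (true ∷ [])             = ⊤
CycleSearchTree (true ∷ _ ∷ _)          = ⊥
CycleSearchTree (false ∷ [])            = ⊤
CycleSearchTree (false ∷ false ∷ [])    = ⊤
CycleSearchTree (false ∷ false ∷ _ ∷ _) = ⊥
CycleSearchTree (false ∷ true ∷ σ)      = CycleSearchTree σ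

cycleSearchAlgorithm : Algorithm
cycleSearchAlgorithm = record { T = CycleSearchTree ; G = cycleSearch 0 }

CycleSearchTree-prefixClosed : ∀ σ τ → CycleSearchTree (σ ++ τ) → CycleSearchTree σ
CycleSearchTree-prefixClosed []                      _ _ = tt
CycleSearchTree-prefixClosed (true ∷ [])             _ _ = tt
CycleSearchTree-prefixClosed (true ∷ _ ∷ _)          _ ()
CycleSearchTree-prefixClosed (false ∷ [])            _ _ = tt
CycleSearchTree-prefixClosed (false ∷ false ∷ [])    _ _ = tt
CycleSearchTree-prefixClosed (false ∷ false ∷ _ ∷ _) _ ()
CycleSearchTree-prefixClosed (false ∷ true ∷ σ)      τ t =
  CycleSearchTree-prefixClosed σ τ t

cycleSearch-leaf : ∀ m σ → CycleSearchTree σ →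
  IsAnswer (cycleSearch m σ) ⇔ IsLeaf cycleSearchAlgorithm σ
cycleSearch-leaf m [] _ =
  mk⇔ (λ ()) (λ leaf → contradiction (leaf (true ∷ []) tt) λ ())
cycleSearch-leaf m (true ∷ []) _ =
  mk⇔ (λ _ → λ { [] _ → refl ; (_ ∷ _) () }) (λ _ → tt)
cycleSearch-leaf m (false ∷ []) _ =
  mk⇔ (λ ()) (λ leaf → contradiction (leaf (false ∷ []) tt) λ ())
cycleSearch-leaf m (false ∷ false ∷ []) _ =
  mk⇔ (λ _ → λ { [] _ → refl ; (_ ∷ _) () }) (λ _ → tt)
cycleSearch-leaf m (false ∷ true ∷ σ) t = cycleSearch-leaf (suc m) σ t

cycleSearch-isAlgorithm : IsAlgorithm cycleSearchAlgorithm
cycleSearch-isAlgorithm = CycleSearchTree-prefixClosed , cycleSearch-leaf 0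

rounds : ℕ → List Bool
rounds zero    = []
rounds (suc m) = (rounds m • false) • true

rounds-++ : ∀ m σ → rounds (suc m) ++ σ ≡ rounds m ++ false ∷ true ∷ σ
rounds-++ m σ = trans (++-assoc (rounds m • false) (true ∷ []) σ)
                      (++-assoc (rounds m) (false ∷ []) (true ∷ σ))

cycleSearch-rounds : ∀ m k σ → cycleSearch k (rounds m ++ σ) ≡ cycleSearch (m + k) σ
cycleSearch-rounds zero    k σ = refl
cycleSearch-rounds (suc m) k σ = trans (cong (cycleSearch k) (rounds-++ m σ))
                                       (cycleSearch-rounds m k (false ∷ true ∷ σ))

G-rounds : ∀ m σ → G cycleSearchAlgorithm (rounds m ++ σ) ≡ cycleSearch m σ
G-rounds m σ =
  trans (cycleSearch-rounds m 0 σ) (cong (λ k → cycleSearch k σ) (+-identityʳ m))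

CycleSearchTree-rounds : ∀ m σ → CycleSearchTree σ → CycleSearchTree (rounds m ++ σ)
CycleSearchTree-rounds zero    σ t = t
CycleSearchTree-rounds (suc m) σ t = subst CycleSearchTree (sym (rounds-++ m σ))
  (CycleSearchTree-rounds m (false ∷ true ∷ σ) t)

OnPath-round : ∀ {A} m σ {F b} → OnPath cycleSearchAlgorithm A (rounds m ++ σ) →
  cycleSearch m σ ≡ query F → HomB F A b → CycleSearchTree (σ • b) →
  OnPath cycleSearchAlgorithm A (rounds m ++ σ • b)
OnPath-round {A} m σ {b = b} onPath Gσ hb t =
  subst (OnPath cycleSearchAlgorithm A) (++-assoc (rounds m) σ (b ∷ []))
    (step onPath (trans (G-rounds m σ) Gσ) hb
      (subst CycleSearchTree (sym (++-assoc (rounds m) σ (b ∷ [])))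
        (CycleSearchTree-rounds m (σ • b) t)))

NoCycleHomBelow-suc : ∀ {A m} → NoCycleHomBelow m A → ¬ Hom (cycle m) A →
  NoCycleHomBelow (suc m) A
NoCycleHomBelow-suc none ¬c d<1+m with m≤n⇒m<n∨m≡n (s≤s⁻¹ d<1+m)
... | inj₁ d<m  = none d<m
... | inj₂ refl = ¬c

DecidesOn : Algorithm → (Digraph → Set) → Digraph → Set
DecidesOn alg C A = Σ (List Bool) λ σ → OnPath alg A σ ×
  Σ Bool λ b → (G alg σ ≡ answer b) × ((b ≡ true) ⇔ C A)

Verdict : Digraph → Set
Verdict = DecidesOn cycleSearchAlgorithm HasDirectedCycle

AtRound : Digraph → ℕ → Set
AtRound A m = OnPath cycleSearchAlgorithm A (rounds m ++ []) × NoCycleHomBelow m A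

round : ∀ {A} m → AtRound A m → Verdict A ⊎ (AtRound A (suc m) × Hom (path (suc m)) A)
round {A} m (onPath , none) with hom? (cycle m) A
... | yes c = inj₁ (_ , OnPath-round m [] onPath refl c tt , true , G-rounds m (true ∷ []) ,
                    mk⇔ (λ _ → shortestCycleHom⇒directedCycle {A} c none) (λ _ → refl))
... | no ¬c with OnPath-round m [] onPath refl ¬c tt | hom? (path (suc m)) A
...   | onPath′ | no ¬p =
  inj₁ (_ , OnPath-round m (false ∷ []) onPath′ refl ¬p tt , false ,
        G-rounds m (false ∷ false ∷ []) ,
        mk⇔ (λ ()) (λ cyclic → contradiction (directedCycle⇒pathHom {A} cyclic (suc m)) ¬p))
...   | onPath′ | yes p =
  inj₂ ((subst (OnPath cycleSearchAlgorithm A) (sym (rounds-++ m []))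
                (OnPath-round m (false ∷ []) onPath′ refl p tt) ,
         NoCycleHomBelow-suc {A} none ¬c) , p)

-- r bounds the rounds still to come: round n A cannot continue, by
-- longPath⇒cycleHom.
decideFrom : ∀ A m r → r + m ≡ Digraph.n A → AtRound A m → Verdict A
decideFrom A m r r+m≡n at with round m at
... | inj₁ verdict = verdict
decideFrom A m zero refl _ | inj₂ ((_ , none′) , p)
  with d , d≤n , c ← longPath⇒cycleHom {A} p
  = contradiction c (none′ (s≤s d≤n))
decideFrom A m (suc r) r+m≡n _ | inj₂ (at′ , _) =
  decideFrom A (suc m) r (trans (+-suc r m) r+m≡n) at′

cycleSearch-decides : Decides cycleSearchAlgorithm HasDirectedCycle
cycleSearch-decides A = decideFrom A 0 (Digraph.n A) (+-identityʳ _) (start tt , λ ())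

theorem21 :
    (Σ Algorithm λ alg → IsAlgorithm alg × Decides alg HasDirectedCycle)
    × (∀ (k : ℕ) → ¬ (Σ Algorithm λ alg →
         IsAlgorithm alg × Decides alg HasDirectedCycle × IsKQuery k alg))
theorem21 =
  (cycleSearchAlgorithm , cycleSearch-isAlgorithm , cycleSearch-decides) ,
  noKQueryAlgorithm
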